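{- Let $n\in\mathbb N$ and $0<\varepsilon,\alpha<1/3$ with $\frac1n\le\varepsilon\le\alpha/32$. Let $D$ be an $n$-vertex $\varepsilon n$-bipseudorandom digraph with $\delta(D)\ge 2\alpha n$, and let $U\subseteq V(D)$ with $|U|\le\alpha n/4$. Then for every integer $2\le k\le(1-8\varepsilon)n-|U|$ and every $(*_1,*_2)\in\{+,-\}^2$, there exists a bidirected path on $k$ vertices in $D-U$ with startpoint $v$ and endpoint $v'$ satisfying $d^{*_1}_D(v)\ge\alpha n/2$ and $d^{*_2}_D(v')\ge\alpha n/2$.
   Context: $\delta(D)$ is the minimum total degree (indegree plus outdegree); $d^+_D,d^-_D$ are out- and indegree in $D$. $D-U$ is the subdigraph induced on $V(D)\setminus U$. For $1\le t\le n/2$, an $n$-vertex digraph is $t$-bipseudorandom if for every pair of disjoint vertex sets $U',W$ with $|U'|=|W|=t$ there exist $u\in U'$, $w\in W$ with both $uw$ and $wu$ edges (here $\varepsilon n$ is treated as an integer). A bidirected path $(w_1,\dots,w_k)$ is a sequence of distinct vertices with both $w_iw_{i+1}$ and $w_{i+1}w_i$ edges for all $i$; $w_1$ is its startpoint and $w_k$ its endpoint.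
   Formalization: The parameter α ranges over the rationals. -}

module Defs where

open import Data.Bool using (Bool; true; false)
open import Data.Nat using (ℕ; zero; suc; _∸_)
open import Data.Integer using (+_)
open import Data.Rational using (ℚ; _/_)
open import Data.Fin using (Fin; toℕ)
open import Data.Fin.Subset using (Subset; _∈_; _∉_; ∣_∣)
open import Data.Vec using (tabulate)
open import Data.Product using (_×_; ∃)
open import Relation.Binary.PropositionalEquality using (_≡_; _≢_)
open import Relation.Nullary using (¬_)
open import Function.Definitions using (Injective)

record Digraph (n : ℕ) : Set where
  field
    edge    : Fin n → Fin n → Bool
    noLoops : ∀ v → edge v v ≡ false
open Digraph public

Edge : ∀ {n} → Digraph n → Fin n → Fin n → Set
Edge D u w = edge D u w ≡ true

⟦_⟧ : ℕ → ℚ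
⟦ m ⟧ = + m / 1

outdeg : ∀ {n} → Digraph n → Fin n → ℕ
outdeg D v = ∣ tabulate (λ w → edge D v w) ∣

indeg : ∀ {n} → Digraph n → Fin n → ℕ
indeg D v = ∣ tabulate (λ w → edge D w v) ∣

data Sign : Set where
  plus minus : Sign

deg : ∀ {n} → Sign → Digraph n → Fin n → ℕ
deg plus  D v = outdeg D v
deg minus D v = indeg D v

-- total degree d^+(v) + d^-(v); δ(D) ≥ x  is expressed as  ∀ v → x ≤ totdeg D v
totdeg : ∀ {n} → Digraph n → Fin n → ℕ
totdeg D v = outdeg D v Data.Nat.+ indeg D v

Disjoint : ∀ {n} → Subset n → Subset n → Set
Disjoint A B = ∀ x → x ∈ A → x ∉ B

Bipseudorandom : ∀ {n} → ℕ → Digraph n → Set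
Bipseudorandom {n} t D =
  (U' W : Subset n) → ∣ U' ∣ ≡ t → ∣ W ∣ ≡ t → Disjoint U' W →
  ∃ λ u → ∃ λ w → u ∈ U' × w ∈ W × Edge D u w × Edge D w u

IsBidirectedPath : ∀ {n k} → Digraph n → (Fin k → Fin n) → Set
IsBidirectedPath {k = k} D p =
  Injective _≡_ _≡_ p ×
  (∀ (i j : Fin k) → toℕ j ≡ suc (toℕ i) → Edge D (p i) (p j) × Edge D (p j) (p i))

Avoids : ∀ {n k} → Subset n → (Fin k → Fin n) → Set
Avoids U p = ∀ i → p i ∉ U

module Submission where

-- Call v high for the sign s if d^s(v) ≥ αn/2. Every vertex has d⁺(v) + d⁻(v) ≥ 2αn, so a vertex
-- that is not high for s has d^{-s}(v) ≥ d^s(v) + αn; as Σ d⁺ = Σ d⁻, double counting shows that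
-- at least |U| + 2εn vertices are high for each sign. Pick disjoint εn-sets R₁, R₂ of high
-- vertices outside U. By bipseudorandomness fewer than εn vertices have no bidirected neighbour in
-- Rᵢ; removing them together with U, R₁ and R₂ leaves a set X. Depth-first search in X finds a
-- bidirected path on more than |X| − 2εn vertices: once εn vertices are finished, fewer than εn
-- are still unvisited, because finished and unvisited vertices are never adjacent. Its first
-- k − 2 vertices, extended by a neighbour in R₁ at the front and one in R₂ at the back, form the
-- required path.

open import Defs
open import Data.Bool as Bool using (Bool; true; false; if_then_else_)
open import Data.Fin using (Fin; zero; suc; toℕ)
open import Data.Fin.Properties using (any?)
open import Data.Fin.Subset using (Subset; Nonempty; ∁; _∈_; _∉_; ∣_∣; _⊆_; _∪_; _─_; ⁅_⁆; ⊥; inside; outside)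
open import Data.Fin.Subset.Properties
  using (∉⊥; ∣⊥∣≡0; nonempty?; Empty-unique; p─⊥≡p; x∈⁅x⁆; x∈⁅y⁆⇒x≡y; ∪-identityʳ; _∈?_; p─q⊆p;
         x∈p∪q⁻; x∈p∪q⁺; x∈∁p⇒x∉p; ∣∁p∣≡n∸∣p∣; ∣p∣≤n)
open import Data.Integer as ℤ using (+_)
import Data.Integer.Properties as ℤ
open import Data.List using (List; []; _∷_; length; take; _++_; [_]; head; lookup)
open import Data.List.Membership.Propositional using () renaming (_∈_ to _∈ₗ_; _∉_ to _∉ₗ_)
open import Data.List.Membership.Propositional.Properties using (∈-++⁻; ∈-lookup)
open import Data.List.Properties using (length-take; length-++)
open import Data.List.Relation.Unary.All as All using (All; []; _∷_)
open import Data.List.Relation.Unary.All.Properties as All using (¬Any⇒All¬)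
open import Data.List.Relation.Unary.Any using (here; there)
open import Data.List.Relation.Unary.Linked as Linked using (Linked; []; [-]; _∷_; _∷′_)
open import Data.List.Relation.Unary.Unique.Propositional using (Unique; []; _∷_)
open import Data.List.Relation.Unary.Unique.Propositional.Properties as Unique using (Unique[x∷xs]⇒x∉xs)
open import Data.Maybe using (just)
open import Data.Maybe.Relation.Binary.Connected using (Connected; just; just-nothing)
open import Data.Nat as ℕ using (ℕ; zero; suc; z≤n; s≤s; _≤_; _∸_)
open import Data.Nat.Coprimality as Coprime using (1-coprimeTo)
open import Data.Nat.Induction using (<-wellFounded)
open import Data.Nat.Properties as ℕ
  using (≤-refl; ≤-trans; ≤-reflexive; +-suc; +-comm; +-monoʳ-≤; +-monoˡ-≤; +-cancelʳ-≤)
open import Data.Nat.Solver using () renaming (module +-*-Solver to ℕ-Solver)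
open import Algebra.Properties.CommutativeMonoid.Sum ℕ.+-0-commutativeMonoid using (sum; ∑-comm; sum-cong-≗)
open import Algebra.Properties.CommutativeSemigroup ℕ.+-commutativeSemigroup using (interchange)
open import Data.Product using (∃; _×_; _,_; proj₁; proj₂; swap)
open import Data.Rational using (ℚ; _/_; 0ℚ; 1ℚ; _+_; _-_; _*_; _<_) renaming (_≤_ to _≤ℚ_)
import Data.Rational as ℚ
import Data.Rational.Properties as ℚ
open import Data.Rational.Solver using () renaming (module +-*-Solver to ℚ-Solver)
open import Data.Sum as Sum using (_⊎_; inj₁; inj₂; [_,_]′)
open import Data.Vec using (_∷_; []; here; there; tabulate)
open import Data.Vec.Properties using ([]=⇒lookup; lookup⇒[]=; lookup∘tabulate)
open import Function using (_∘_)
open import Induction.WellFounded using (Acc; acc)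
open import Relation.Binary using (Symmetric) renaming (Decidable to Decidable₂)
open import Relation.Binary.PropositionalEquality
  using (_≡_; _≢_; refl; sym; trans; cong; cong₂; subst; subst₂; module ≡-Reasoning)
open import Relation.Nullary using (¬_; yes; no; does; contradiction)
open import Relation.Nullary.Decidable using (dec-true; ¬?; _×-dec_; decidable-stable)
open import Relation.Unary using (Pred; Decidable)

private
  variable
    n : ℕ

∣p∪q∣≤∣p∣+∣q∣ : ∀ (p q : Subset n) → ∣ p ∪ q ∣ ≤ ∣ p ∣ ℕ.+ ∣ q ∣
∣p∪q∣≤∣p∣+∣q∣ []            []            = z≤n
∣p∪q∣≤∣p∣+∣q∣ (inside  ∷ p) (outside ∷ q) = s≤s (∣p∪q∣≤∣p∣+∣q∣ p q)
∣p∪q∣≤∣p∣+∣q∣ (inside  ∷ p) (inside  ∷ q) = s≤s (≤-trans (∣p∪q∣≤∣p∣+∣q∣ p q) (+-monoʳ-≤ ∣ p ∣ (ℕ.n≤1+n ∣ q ∣)))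
∣p∪q∣≤∣p∣+∣q∣ (outside ∷ p) (inside  ∷ q) = ≤-trans (s≤s (∣p∪q∣≤∣p∣+∣q∣ p q)) (≤-reflexive (sym (+-suc ∣ p ∣ ∣ q ∣)))
∣p∪q∣≤∣p∣+∣q∣ (outside ∷ p) (outside ∷ q) = ∣p∪q∣≤∣p∣+∣q∣ p q

∣p∣≤∣p─q∣+∣q∣ : ∀ (p q : Subset n) → ∣ p ∣ ≤ ∣ p ─ q ∣ ℕ.+ ∣ q ∣
∣p∣≤∣p─q∣+∣q∣ []            []            = z≤n
∣p∣≤∣p─q∣+∣q∣ (inside  ∷ p) (outside ∷ q) = s≤s (∣p∣≤∣p─q∣+∣q∣ p q)
∣p∣≤∣p─q∣+∣q∣ (inside  ∷ p) (inside  ∷ q) = ≤-trans (s≤s (∣p∣≤∣p─q∣+∣q∣ p q)) (≤-reflexive (sym (+-suc _ ∣ q ∣)))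
∣p∣≤∣p─q∣+∣q∣ (outside ∷ p) (inside  ∷ q) = ≤-trans (∣p∣≤∣p─q∣+∣q∣ p q) (+-monoʳ-≤ ∣ p ─ q ∣ (ℕ.n≤1+n ∣ q ∣))
∣p∣≤∣p─q∣+∣q∣ (outside ∷ p) (outside ∷ q) = ∣p∣≤∣p─q∣+∣q∣ p q

∣q∣+m≤∣p∣⇒m≤∣p─q∣ : ∀ (p q : Subset n) {m} → ∣ q ∣ ℕ.+ m ≤ ∣ p ∣ → m ≤ ∣ p ─ q ∣
∣q∣+m≤∣p∣⇒m≤∣p─q∣ p q {m} le = ℕ.+-cancelˡ-≤ ∣ q ∣ m _
  (≤-trans le (≤-trans (∣p∣≤∣p─q∣+∣q∣ p q) (≤-reflexive (+-comm _ ∣ q ∣))))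

x∈p─q⇒x∉q : ∀ {p q : Subset n} {x} → x ∈ p ─ q → x ∉ q
x∈p─q⇒x∉q {p = _ ∷ p} {outside ∷ q} here        ()
x∈p─q⇒x∉q {p = _ ∷ p} {_       ∷ q} (there x∈) (there x∈q) = x∈p─q⇒x∉q x∈ x∈q

x∈p⇒suc∣p─⁅x⁆∣≡∣p∣ : ∀ {p : Subset n} {x} → x ∈ p → suc ∣ p ─ ⁅ x ⁆ ∣ ≡ ∣ p ∣
x∈p⇒suc∣p─⁅x⁆∣≡∣p∣ {p = inside  ∷ p} {zero}  here       = cong (suc ∘ ∣_∣) (p─⊥≡p p)
x∈p⇒suc∣p─⁅x⁆∣≡∣p∣ {p = inside  ∷ p} {suc x} (there x∈) = cong suc (x∈p⇒suc∣p─⁅x⁆∣≡∣p∣ x∈)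
x∈p⇒suc∣p─⁅x⁆∣≡∣p∣ {p = outside ∷ p} {suc x} (there x∈) = x∈p⇒suc∣p─⁅x⁆∣≡∣p∣ x∈

x∉p⇒∣p∪⁅x⁆∣≡suc∣p∣ : ∀ {p : Subset n} {x} → x ∉ p → ∣ p ∪ ⁅ x ⁆ ∣ ≡ suc ∣ p ∣
x∉p⇒∣p∪⁅x⁆∣≡suc∣p∣ {p = inside  ∷ p} {zero}  x∉ = contradiction here x∉
x∉p⇒∣p∪⁅x⁆∣≡suc∣p∣ {p = outside ∷ p} {zero}  x∉ = cong (suc ∘ ∣_∣) (∪-identityʳ p)
x∉p⇒∣p∪⁅x⁆∣≡suc∣p∣ {p = inside  ∷ p} {suc x} x∉ = cong suc (x∉p⇒∣p∪⁅x⁆∣≡suc∣p∣ (x∉ ∘ there))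
x∉p⇒∣p∪⁅x⁆∣≡suc∣p∣ {p = outside ∷ p} {suc x} x∉ = x∉p⇒∣p∪⁅x⁆∣≡suc∣p∣ (x∉ ∘ there)

x∈p∪⁅y⁆⇒x∈p⊎x≡y : ∀ (p : Subset n) y {x} → x ∈ p ∪ ⁅ y ⁆ → x ∈ p ⊎ x ≡ y
x∈p∪⁅y⁆⇒x∈p⊎x≡y p y x∈ = Sum.map₂ (x∈⁅y⁆⇒x≡y y) (x∈p∪q⁻ p ⁅ y ⁆ x∈)

x∉p∪q⇒x∉p×x∉q : ∀ {p q : Subset n} {x} → x ∉ p ∪ q → x ∉ p × x ∉ q
x∉p∪q⇒x∉p×x∉q x∉ = x∉ ∘ x∈p∪q⁺ ∘ inj₁ , x∉ ∘ x∈p∪q⁺ ∘ inj₂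

∣p∣>0⇒Nonempty : ∀ (p : Subset n) → 0 ℕ.< ∣ p ∣ → Nonempty p
∣p∣>0⇒Nonempty {n} p ∣p∣>0 with nonempty? p
... | yes ne = ne
... | no ¬ne = contradiction (trans (cong ∣_∣ (Empty-unique ¬ne)) (∣⊥∣≡0 n)) (ℕ.>⇒≢ ∣p∣>0)

⊆-ofSize : ∀ {t} (p : Subset n) → t ≤ ∣ p ∣ → ∃ λ q → q ⊆ p × ∣ q ∣ ≡ t
⊆-ofSize {n} {zero} p _ = ⊥ , (λ x∈⊥ → contradiction x∈⊥ ∉⊥) , ∣⊥∣≡0 n
⊆-ofSize {t = suc t} (inside ∷ p) (s≤s t≤) with ⊆-ofSize p t≤
... | q , q⊆p , ∣q∣≡t = inside ∷ q , (λ { here → here ; (there x∈) → there (q⊆p x∈) }) , cong suc ∣q∣≡t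
⊆-ofSize {t = suc t} (outside ∷ p) t≤ with ⊆-ofSize p t≤
... | q , q⊆p , ∣q∣≡t = outside ∷ q , (λ { (there x∈) → there (q⊆p x∈) }) , ∣q∣≡t

subsetOf : ∀ {ℓ} {P : Pred (Fin n) ℓ} → Decidable P → Subset n
subsetOf P? = tabulate (does ∘ P?)

module _ {ℓ} {P : Pred (Fin n) ℓ} (P? : Decidable P) where

  ∈-subsetOf⁻ : ∀ {x} → x ∈ subsetOf P? → P x
  ∈-subsetOf⁻ {x} x∈ with P? x | trans (sym (lookup∘tabulate _ x)) ([]=⇒lookup x∈)
  ... | yes px | _ = px

  ∈-subsetOf⁺ : ∀ {x} → P x → x ∈ subsetOf P?
  ∈-subsetOf⁺ {x} px = lookup⇒[]= x _ (trans (lookup∘tabulate _ x) (dec-true (P? x) px))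

∣tabulate∣≡∑ : ∀ (f : Fin n → Bool) → ∣ tabulate f ∣ ≡ sum (λ i → if f i then 1 else 0)
∣tabulate∣≡∑ {zero}  f = refl
∣tabulate∣≡∑ {suc n} f with f zero
... | true  = cong suc (∣tabulate∣≡∑ (f ∘ suc))
... | false = ∣tabulate∣≡∑ (f ∘ suc)

∑-weighted-count : ∀ (d d′ : Fin n → ℕ) (f : Fin n → Bool) (b m : ℕ) →
  (∀ v → b ℕ.+ d v ≤ d′ v ℕ.+ (if f v then m else 0)) →
  n ℕ.* b ℕ.+ sum d ≤ sum d′ ℕ.+ ∣ tabulate f ∣ ℕ.* m
∑-weighted-count {zero}  d d′ f b m _ = z≤n
∑-weighted-count {suc n} d d′ f b m pointwise =
  subst₂ _≤_ (interchange b (d zero) (n ℕ.* b) (sum (d ∘ suc)))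
               (trans (interchange (d′ zero) _ (sum (d′ ∘ suc)) _) (cong (sum d′ ℕ.+_) head-weight))
    (ℕ.+-mono-≤ (pointwise zero) (∑-weighted-count (d ∘ suc) (d′ ∘ suc) (f ∘ suc) b m (pointwise ∘ suc)))
  where
  head-weight : (if f zero then m else 0) ℕ.+ ∣ tabulate (f ∘ suc) ∣ ℕ.* m ≡ ∣ tabulate f ∣ ℕ.* m
  head-weight with f zero
  ... | true  = refl
  ... | false = refl

Linked-take⁺ : ∀ {a ℓ} {A : Set a} {R : A → A → Set ℓ} {xs} m → Linked R xs → Linked R (take m xs)
Linked-take⁺ zero          _         = []
Linked-take⁺ (suc m)       []        = []
Linked-take⁺ (suc zero)    [-]       = [-]
Linked-take⁺ (suc (suc m)) [-]       = [-]
Linked-take⁺ (suc zero)    (_ ∷ _)   = [-]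
Linked-take⁺ (suc (suc m)) (r ∷ rs)  = r ∷ Linked-take⁺ (suc m) rs

module _ {a} {A : Set a} where

  ∷-unique : ∀ {x : A} {xs} → x ∉ₗ xs → Unique xs → Unique (x ∷ xs)
  ∷-unique {xs = xs} x∉ u = ¬Any⇒All¬ xs x∉ ∷ u

  lookup-injective : ∀ {xs : List A} → Unique xs → ∀ {i j} → lookup xs i ≡ lookup xs j → i ≡ j
  lookup-injective (_ ∷ _)        {zero}  {zero}  _  = refl
  lookup-injective (x≢xs ∷ _)     {zero}  {suc j} eq = contradiction eq (All.lookup x≢xs (∈-lookup j))
  lookup-injective (x≢xs ∷ _)     {suc i} {zero}  eq = contradiction (sym eq) (All.lookup x≢xs (∈-lookup i))
  lookup-injective (_ ∷ unique)   {suc i} {suc j} eq = cong suc (lookup-injective unique eq)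

  lookup-linked : ∀ {ℓ} {R : A → A → Set ℓ} {xs} → Linked R xs →
                  ∀ i j → toℕ j ≡ suc (toℕ i) → R (lookup xs i) (lookup xs j)
  lookup-linked (r ∷ _)  zero    (suc zero)    _  = r
  lookup-linked (_ ∷ rs) (suc i) (suc j)       eq = lookup-linked rs i j (ℕ.suc-injective eq)
  lookup-linked [-]      zero    (suc ())      _
  lookup-linked (_ ∷ _)  zero    (suc (suc j)) ()

  lookup-∷ʳ-last : ∀ (xs : List A) y (i : Fin (length (xs ++ [ y ]))) → toℕ i ≡ length xs →
                   lookup (xs ++ [ y ]) i ≡ y
  lookup-∷ʳ-last []       y zero    _  = refl
  lookup-∷ʳ-last (_ ∷ xs) y (suc i) eq = lookup-∷ʳ-last xs y i (ℕ.suc-injective eq)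

-- Paths in a pseudorandom symmetric relation

Pseudorandom : (Fin n → Fin n → Set) → ℕ → Set
Pseudorandom {n} _~_ t = (S T : Subset n) → ∣ S ∣ ≡ t → ∣ T ∣ ≡ t → Disjoint S T →
  ∃ λ u → ∃ λ w → u ∈ S × w ∈ T × u ~ w

module Paths {_~_ : Fin n → Fin n → Set} (_~?_ : Decidable₂ _~_) (~-sym : Symmetric _~_)
             {t : ℕ} (pseudo : Pseudorandom _~_ t) where

  open ℕ-Solver using (solve; _:+_; _:*_; con; _:=_)

  IsPathIn : Subset n → List (Fin n) → Set
  IsPathIn X L = Linked _~_ L × Unique L × All (_∈ X) L

  HasNeighbourIn : Subset n → Fin n → Set
  HasNeighbourIn R v = ∃ λ w → w ∈ R × v ~ w

  hasNeighbourIn? : ∀ R → Decidable (HasNeighbourIn R)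
  hasNeighbourIn? R v = any? (λ w → (w ∈? R) ×-dec (v ~? w))

  no-edges⇒∣p∣<t : ∀ {p q} → ∣ q ∣ ≡ t → Disjoint p q → (∀ {u w} → u ∈ p → w ∈ q → ¬ u ~ w) →
                    ∣ p ∣ ℕ.< t
  no-edges⇒∣p∣<t {p} {q} ∣q∣≡t p∩q≡∅ no-edge with t ℕ.≤? ∣ p ∣
  ... | no t≰∣p∣ = ℕ.≰⇒> t≰∣p∣
  ... | yes t≤∣p∣ with ⊆-ofSize p t≤∣p∣
  ... | p′ , p′⊆p , ∣p′∣≡t with pseudo p′ q ∣p′∣≡t ∣q∣≡t (λ x → p∩q≡∅ x ∘ p′⊆p)
  ... | u , w , u∈p′ , w∈q , u~w = contradiction u~w (no-edge (p′⊆p u∈p′) w∈q)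

  IsolatedFrom : Subset n → Fin n → Set
  IsolatedFrom R v = v ∉ R × ¬ HasNeighbourIn R v

  isolatedFrom? : ∀ R → Decidable (IsolatedFrom R)
  isolatedFrom? R v = ¬? (v ∈? R) ×-dec ¬? (hasNeighbourIn? R v)

  isolatedFrom : Subset n → Subset n
  isolatedFrom R = subsetOf (isolatedFrom? R)

  ∣isolatedFrom∣<t : ∀ R → ∣ R ∣ ≡ t → ∣ isolatedFrom R ∣ ℕ.< t
  ∣isolatedFrom∣<t R ∣R∣≡t = no-edges⇒∣p∣<t ∣R∣≡t (λ _ → proj₁ ∘ isolated)
    (λ u∈I w∈R u~w → proj₂ (isolated u∈I) (_ , w∈R , u~w))
    where
    isolated : ∀ {x} → x ∈ isolatedFrom R → IsolatedFrom R x
    isolated = ∈-subsetOf⁻ (isolatedFrom? R)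

  neighbourIn : ∀ {R v} → v ∉ R → v ∉ isolatedFrom R → HasNeighbourIn R v
  neighbourIn {R} {v} v∉R v∉I =
    decidable-stable (hasNeighbourIn? R v) (λ ¬has → v∉I (∈-subsetOf⁺ (isolatedFrom? R) (v∉R , ¬has)))

  blocked : (U R₁ R₂ : Subset n) → Subset n
  blocked U R₁ R₂ = U ∪ (R₁ ∪ (R₂ ∪ (isolatedFrom R₁ ∪ isolatedFrom R₂)))

  ∣blocked∣+2≤ : ∀ U {R₁ R₂} → ∣ R₁ ∣ ≡ t → ∣ R₂ ∣ ≡ t → ∣ blocked U R₁ R₂ ∣ ℕ.+ 2 ≤ ∣ U ∣ ℕ.+ 4 ℕ.* t
  ∣blocked∣+2≤ U {R₁} {R₂} ∣R₁∣≡t ∣R₂∣≡t = begin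
    ∣ blocked U R₁ R₂ ∣ ℕ.+ 2
      ≤⟨ +-monoˡ-≤ 2 (∪-bound U ≤-refl (∪-bound R₁ (≤-reflexive ∣R₁∣≡t)
                       (∪-bound R₂ (≤-reflexive ∣R₂∣≡t) (∣p∪q∣≤∣p∣+∣q∣ I₁ I₂)))) ⟩
    ∣ U ∣ ℕ.+ (t ℕ.+ (t ℕ.+ (∣ I₁ ∣ ℕ.+ ∣ I₂ ∣))) ℕ.+ 2
      ≡⟨ solve 4 (λ u t a b → u :+ (t :+ (t :+ (a :+ b))) :+ con 2
                             := u :+ (t :+ (t :+ ((con 1 :+ a) :+ (con 1 :+ b))))) refl ∣ U ∣ t (∣ I₁ ∣) (∣ I₂ ∣) ⟩
    ∣ U ∣ ℕ.+ (t ℕ.+ (t ℕ.+ (suc ∣ I₁ ∣ ℕ.+ suc ∣ I₂ ∣)))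
      ≤⟨ +-monoʳ-≤ ∣ U ∣ (+-monoʳ-≤ t (+-monoʳ-≤ t
           (ℕ.+-mono-≤ (∣isolatedFrom∣<t R₁ ∣R₁∣≡t) (∣isolatedFrom∣<t R₂ ∣R₂∣≡t)))) ⟩
    ∣ U ∣ ℕ.+ (t ℕ.+ (t ℕ.+ (t ℕ.+ t)))
      ≡⟨ solve 2 (λ u t → u :+ (t :+ (t :+ (t :+ t))) := u :+ con 4 :* t) refl ∣ U ∣ t ⟩
    ∣ U ∣ ℕ.+ 4 ℕ.* t ∎
    where
    open ℕ.≤-Reasoning
    I₁ = isolatedFrom R₁
    I₂ = isolatedFrom R₂
    ∪-bound : ∀ p {q : Subset n} {a b} → ∣ p ∣ ≤ a → ∣ q ∣ ≤ b → ∣ p ∪ q ∣ ≤ a ℕ.+ b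
    ∪-bound p {q} p≤ q≤ = ≤-trans (∣p∪q∣≤∣p∣+∣q∣ p q) (ℕ.+-mono-≤ p≤ q≤)

  LongPathIn : Subset n → Set
  LongPathIn X = ∃ λ L → IsPathIn X L × ∣ X ∣ ℕ.< length L ℕ.+ 2 ℕ.* t

  module DepthFirstSearch (X : Subset n) (t≤∣X∣ : t ≤ ∣ X ∣) where

    record Search (stack : List (Fin n)) : Set where
      field
        done todo   : Subset n
        linked      : Linked _~_ stack
        unique      : Unique stack
        stack⊆X     : All (_∈ X) stack
        stack∉done  : ∀ {x} → x ∈ₗ stack → x ∉ done
        stack∉todo  : ∀ {x} → x ∈ₗ stack → x ∉ todo
        todo⊆X      : todo ⊆ X
        done∩todo≡∅ : Disjoint done todo
        no-edge     : ∀ {u w} → u ∈ done → w ∈ todo → ¬ u ~ w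
        ∣done∣≤t    : ∣ done ∣ ≤ t
        sizes       : ∣ done ∣ ℕ.+ ∣ todo ∣ ℕ.+ length stack ≡ ∣ X ∣

    open Search

    -- decreases by one at every push and every pop
    measure : ∀ {P} → Search P → ℕ
    measure {P} s = 2 ℕ.* ∣ todo s ∣ ℕ.+ length P

    start : Search []
    start = record
      { done = ⊥ ; todo = X
      ; linked = [] ; unique = [] ; stack⊆X = []
      ; stack∉done = λ () ; stack∉todo = λ ()
      ; todo⊆X = λ x∈X → x∈X
      ; done∩todo≡∅ = λ _ x∈⊥ → contradiction x∈⊥ ∉⊥
      ; no-edge = λ u∈⊥ → contradiction u∈⊥ ∉⊥
      ; ∣done∣≤t = subst (_≤ t) (sym (∣⊥∣≡0 n)) z≤n
      ; sizes = trans (ℕ.+-identityʳ _) (cong (ℕ._+ ∣ X ∣) (∣⊥∣≡0 n))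
      }

    push : ∀ {P w} (s : Search P) → w ∈ todo s → Connected _~_ (just w) (head P) → Search (w ∷ P)
    push {P} {w} s w∈todo w~top = record
      { done = done s ; todo = todo s ─ ⁅ w ⁆
      ; linked = w~top ∷′ linked s
      ; unique = ∷-unique (λ w∈P → stack∉todo s w∈P w∈todo) (unique s)
      ; stack⊆X = todo⊆X s w∈todo ∷ stack⊆X s
      ; stack∉done = λ { (here refl) w∈done → done∩todo≡∅ s w w∈done w∈todo ; (there x∈P) → stack∉done s x∈P }
      ; stack∉todo = λ { (here refl) w∈ → x∈p─q⇒x∉q w∈ (x∈⁅x⁆ w) ; (there x∈P) → stack∉todo s x∈P ∘ shrink }
      ; todo⊆X = todo⊆X s ∘ shrink
      ; done∩todo≡∅ = λ x x∈done → done∩todo≡∅ s x x∈done ∘ shrink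
      ; no-edge = λ u∈done w′∈ → no-edge s u∈done (shrink w′∈)
      ; ∣done∣≤t = ∣done∣≤t s
      ; sizes = begin
          ∣ done s ∣ ℕ.+ ∣ todo s ─ ⁅ w ⁆ ∣ ℕ.+ suc (length P) ≡⟨ +-suc (∣ done s ∣ ℕ.+ _) (length P) ⟩
          suc (∣ done s ∣ ℕ.+ ∣ todo s ─ ⁅ w ⁆ ∣) ℕ.+ length P ≡⟨ cong (ℕ._+ length P) (sym (+-suc ∣ done s ∣ _)) ⟩
          ∣ done s ∣ ℕ.+ suc ∣ todo s ─ ⁅ w ⁆ ∣ ℕ.+ length P   ≡⟨ cong (λ a → ∣ done s ∣ ℕ.+ a ℕ.+ length P) ∣todo∣ ⟩
          ∣ done s ∣ ℕ.+ ∣ todo s ∣ ℕ.+ length P           ≡⟨ sizes s ⟩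
          ∣ X ∣                                            ∎
      }
      where
      ∣todo∣ : suc ∣ todo s ─ ⁅ w ⁆ ∣ ≡ ∣ todo s ∣
      ∣todo∣ = x∈p⇒suc∣p─⁅x⁆∣≡∣p∣ w∈todo
      shrink : todo s ─ ⁅ w ⁆ ⊆ todo s
      shrink = p─q⊆p (todo s) ⁅ w ⁆
      open ≡-Reasoning

    pop : ∀ {v P} (s : Search (v ∷ P)) → ∣ done s ∣ ≢ t → (∀ {w} → w ∈ todo s → ¬ v ~ w) → Search P
    pop {v} {P} s ∣done∣≢t v-stuck = record
      { done = done s ∪ ⁅ v ⁆ ; todo = todo s
      ; linked = Linked.tail (linked s)
      ; unique = unique-tail (unique s)
      ; stack⊆X = All.tail (stack⊆X s)
      ; stack∉done = λ x∈P x∈ → [ stack∉done s (there x∈P) , (λ { refl → v∉P x∈P }) ]′ (grown x∈)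
      ; stack∉todo = stack∉todo s ∘ there
      ; todo⊆X = todo⊆X s
      ; done∩todo≡∅ = λ x x∈ → [ done∩todo≡∅ s x , (λ { refl → stack∉todo s (here refl) }) ]′ (grown x∈)
      ; no-edge = λ u∈ w∈todo → [ (λ u∈done → no-edge s u∈done w∈todo) , (λ { refl → v-stuck w∈todo }) ]′ (grown u∈)
      ; ∣done∣≤t = subst (_≤ t) (sym ∣done∪⁅v⁆∣) (ℕ.≤∧≢⇒< (∣done∣≤t s) ∣done∣≢t)
      ; sizes = begin
          ∣ done s ∪ ⁅ v ⁆ ∣ ℕ.+ ∣ todo s ∣ ℕ.+ length P ≡⟨ cong (λ a → a ℕ.+ ∣ todo s ∣ ℕ.+ length P) ∣done∪⁅v⁆∣ ⟩
          suc (∣ done s ∣ ℕ.+ ∣ todo s ∣ ℕ.+ length P)  ≡⟨ +-suc (∣ done s ∣ ℕ.+ ∣ todo s ∣) (length P) ⟨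
          ∣ done s ∣ ℕ.+ ∣ todo s ∣ ℕ.+ suc (length P)  ≡⟨ sizes s ⟩
          ∣ X ∣                                         ∎
      }
      where
      unique-tail : ∀ {x xs} → Unique (x ∷ xs) → Unique xs
      unique-tail (_ ∷ u) = u
      v∉P : v ∉ₗ P
      v∉P = Unique[x∷xs]⇒x∉xs (unique s)
      grown : ∀ {x} → x ∈ done s ∪ ⁅ v ⁆ → x ∈ done s ⊎ x ≡ v
      grown = x∈p∪⁅y⁆⇒x∈p⊎x≡y (done s) v
      ∣done∪⁅v⁆∣ : ∣ done s ∪ ⁅ v ⁆ ∣ ≡ suc ∣ done s ∣
      ∣done∪⁅v⁆∣ = x∉p⇒∣p∪⁅x⁆∣≡suc∣p∣ (stack∉done s (here refl))
      open ≡-Reasoning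

    push-decreases : ∀ {P w} (s : Search P) (w∈todo : w ∈ todo s) (w~top : Connected _~_ (just w) (head P)) →
                     measure (push s w∈todo w~top) ℕ.< measure s
    push-decreases {P} {w} s w∈todo _ = ≤-reflexive (begin
      suc (2 ℕ.* ∣ todo s ─ ⁅ w ⁆ ∣ ℕ.+ suc (length P))
        ≡⟨ solve 2 (λ a l → con 1 :+ (con 2 :* a :+ (con 1 :+ l)) := con 2 :* (con 1 :+ a) :+ l)
                   refl ∣ todo s ─ ⁅ w ⁆ ∣ (length P) ⟩
      2 ℕ.* suc ∣ todo s ─ ⁅ w ⁆ ∣ ℕ.+ length P
        ≡⟨ cong (λ a → 2 ℕ.* a ℕ.+ length P) (x∈p⇒suc∣p─⁅x⁆∣≡∣p∣ w∈todo) ⟩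
      2 ℕ.* ∣ todo s ∣ ℕ.+ length P                 ∎)
      where open ≡-Reasoning

    pop-decreases : ∀ {v P} (s : Search (v ∷ P)) (∣done∣≢t : ∣ done s ∣ ≢ t) (stuck : ∀ {w} → w ∈ todo s → ¬ v ~ w) →
                    measure (pop s ∣done∣≢t stuck) ℕ.< measure s
    pop-decreases {P = P} s _ _ = ≤-reflexive (sym (+-suc (2 ℕ.* ∣ todo s ∣) (length P)))

    todo-nonempty : (s : Search []) → ∣ done s ∣ ≢ t → 0 ℕ.< ∣ todo s ∣
    todo-nonempty s ∣done∣≢t = ℕ.n≢0⇒n>0 λ ∣todo∣≡0 →
      ℕ.<⇒≱ (ℕ.≤∧≢⇒< (∣done∣≤t s) ∣done∣≢t) (subst (t ≤_) (∣X∣≡∣done∣ ∣todo∣≡0) t≤∣X∣)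
      where
      ∣X∣≡∣done∣ : ∣ todo s ∣ ≡ 0 → ∣ X ∣ ≡ ∣ done s ∣
      ∣X∣≡∣done∣ ∣todo∣≡0 = begin
        ∣ X ∣                            ≡⟨ sizes s ⟨
        ∣ done s ∣ ℕ.+ ∣ todo s ∣ ℕ.+ 0 ≡⟨ cong (λ a → ∣ done s ∣ ℕ.+ a ℕ.+ 0) ∣todo∣≡0 ⟩
        ∣ done s ∣ ℕ.+ 0 ℕ.+ 0          ≡⟨ trans (ℕ.+-identityʳ _) (ℕ.+-identityʳ _) ⟩
        ∣ done s ∣                       ∎
        where open ≡-Reasoning

    finish : ∀ {P} (s : Search P) → ∣ done s ∣ ≡ t → ∣ X ∣ ℕ.< length P ℕ.+ 2 ℕ.* t
    finish {P} s ∣done∣≡t = begin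
      suc ∣ X ∣                                      ≡⟨ cong suc (sym (sizes s)) ⟩
      suc (∣ done s ∣ ℕ.+ ∣ todo s ∣ ℕ.+ length P) ≡⟨ cong (λ d → suc (d ℕ.+ ∣ todo s ∣ ℕ.+ length P)) ∣done∣≡t ⟩
      suc (t ℕ.+ ∣ todo s ∣ ℕ.+ length P)
        ≡⟨ solve 3 (λ t a l → con 1 :+ (t :+ a :+ l) := l :+ t :+ (con 1 :+ a)) refl t ∣ todo s ∣ (length P) ⟩
      length P ℕ.+ t ℕ.+ suc ∣ todo s ∣   ≤⟨ +-monoʳ-≤ (length P ℕ.+ t) ∣todo∣<t ⟩
      length P ℕ.+ t ℕ.+ t                ≡⟨ solve 2 (λ t l → l :+ t :+ t := l :+ con 2 :* t) refl t (length P) ⟩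
      length P ℕ.+ 2 ℕ.* t                ∎
      where
      open ℕ.≤-Reasoning
      ∣todo∣<t : ∣ todo s ∣ ℕ.< t
      ∣todo∣<t = no-edges⇒∣p∣<t ∣done∣≡t (λ x x∈todo x∈done → done∩todo≡∅ s x x∈done x∈todo)
                   (λ u∈todo w∈done u~w → no-edge s w∈done u∈todo (~-sym u~w))

    search : ∀ {P} (s : Search P) → Acc ℕ._<_ (measure s) → LongPathIn X
    search {P} s _ with ∣ done s ∣ ℕ.≟ t
    ... | yes ∣done∣≡t = P , (linked s , unique s , stack⊆X s) , finish s ∣done∣≡t
    search {[]} s (acc smaller) | no ∣done∣≢t with ∣p∣>0⇒Nonempty (todo s) (todo-nonempty s ∣done∣≢t)
    ... | w , w∈todo = search (push s w∈todo just-nothing) (smaller (push-decreases s w∈todo just-nothing))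
    search {v ∷ P} s (acc smaller) | no ∣done∣≢t with hasNeighbourIn? (todo s) v
    ... | yes (w , w∈todo , v~w) =
      search (push s w∈todo (just (~-sym v~w))) (smaller (push-decreases s w∈todo (just (~-sym v~w))))
    ... | no stuck = search (pop s ∣done∣≢t v-stuck) (smaller (pop-decreases s ∣done∣≢t v-stuck))
      where
      v-stuck : ∀ {w} → w ∈ todo s → ¬ v ~ w
      v-stuck w∈todo v~w = stuck (_ , w∈todo , v~w)

  long-path : ∀ X → t ≤ ∣ X ∣ → LongPathIn X
  long-path X t≤∣X∣ = search start (<-wellFounded _)
    where open DepthFirstSearch X t≤∣X∣

  record Connection (R₁ X R₂ : Subset n) (j : ℕ) : Set where
    field
      start end    : Fin n
      inner        : List (Fin n)
      start∈R₁     : start ∈ R₁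
      end∈R₂       : end ∈ R₂
      inner⊆X      : All (_∈ X) inner
      length-inner : length inner ≡ j
      linked       : Linked _~_ (start ∷ inner ++ [ end ])
      unique       : Unique (start ∷ inner ++ [ end ])

  ∷ʳ-neighbour : ∀ {R x xs} → Linked _~_ (x ∷ xs) → All (HasNeighbourIn R) (x ∷ xs) →
                 ∃ λ r → r ∈ R × Linked _~_ (x ∷ xs ++ [ r ])
  ∷ʳ-neighbour {xs = []}    [-]         ((r , r∈R , x~r) ∷ []) = r , r∈R , x~r ∷ [-]
  ∷ʳ-neighbour {xs = _ ∷ _} (x~y ∷ rest) (_ ∷ neighbours) with ∷ʳ-neighbour rest neighbours
  ... | r , r∈R , rest′ = r , r∈R , x~y ∷ rest′

  take-path : ∀ {X L} m → IsPathIn X L → IsPathIn X (take m L)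
  take-path m (linked , unique , L⊆X) = Linked-take⁺ m linked , Unique.take⁺ m unique , All.take⁺ m L⊆X

  extend-to-connection : ∀ {R₁ X R₂ q xs} → Disjoint R₁ R₂ → Disjoint X R₁ → Disjoint X R₂ →
                         (∀ {x} → x ∈ X → HasNeighbourIn R₁ x) → (∀ {x} → x ∈ X → HasNeighbourIn R₂ x) →
                         IsPathIn X (q ∷ xs) → Connection R₁ X R₂ (length (q ∷ xs))
  extend-to-connection {R₁} {X} {R₂} {q} {xs} R₁∩R₂≡∅ X∩R₁≡∅ X∩R₂≡∅ to-R₁ to-R₂ (linked , unique , inX)
    with to-R₁ (All.head inX) | ∷ʳ-neighbour linked (All.map to-R₂ inX)
  ... | r₁ , r₁∈R₁ , q~r₁ | r₂ , r₂∈R₂ , linked′ = record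
    { start = r₁ ; end = r₂ ; inner = q ∷ xs
    ; start∈R₁ = r₁∈R₁ ; end∈R₂ = r₂∈R₂ ; inner⊆X = inX ; length-inner = refl
    ; linked = ~-sym q~r₁ ∷ linked′
    ; unique = ∷-unique r₁∉ (Unique.++⁺ unique ([] ∷ []) r₂∉)
    }
    where
    r₁∉ : r₁ ∉ₗ (q ∷ xs) ++ [ r₂ ]
    r₁∉ r₁∈ with ∈-++⁻ (q ∷ xs) r₁∈
    ... | inj₁ r₁∈xs       = X∩R₁≡∅ r₁ (All.lookup inX r₁∈xs) r₁∈R₁
    ... | inj₂ (here refl)   = R₁∩R₂≡∅ r₁ r₁∈R₁ r₂∈R₂
    r₂∉ : ∀ {v} → ¬ (v ∈ₗ q ∷ xs × v ∈ₗ [ r₂ ])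
    r₂∉ (v∈xs , here refl) = X∩R₂≡∅ r₂ (All.lookup inX v∈xs) r₂∈R₂

  connection : ∀ {R₁ X R₂} → ∣ R₁ ∣ ≡ t → ∣ R₂ ∣ ≡ t → Disjoint R₁ R₂ → Disjoint X R₁ → Disjoint X R₂ →
               (∀ {x} → x ∈ X → HasNeighbourIn R₁ x) → (∀ {x} → x ∈ X → HasNeighbourIn R₂ x) →
               ∀ j → j ℕ.+ 2 ℕ.* t ≤ ∣ X ∣ → Connection R₁ X R₂ j
  connection {R₁} {X} {R₂} ∣R₁∣≡t ∣R₂∣≡t R₁∩R₂≡∅ X∩R₁≡∅ X∩R₂≡∅ to-R₁ to-R₂ zero _
    with pseudo R₁ R₂ ∣R₁∣≡t ∣R₂∣≡t R₁∩R₂≡∅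
  ... | u , w , u∈R₁ , w∈R₂ , u~w = record
    { start = u ; end = w ; inner = []
    ; start∈R₁ = u∈R₁ ; end∈R₂ = w∈R₂ ; inner⊆X = [] ; length-inner = refl
    ; linked = u~w ∷ [-]
    ; unique = ∷-unique (λ { (here refl) → R₁∩R₂≡∅ u u∈R₁ w∈R₂ }) ([] ∷ [])
    }
  connection {R₁} {X} {R₂} ∣R₁∣≡t ∣R₂∣≡t R₁∩R₂≡∅ X∩R₁≡∅ X∩R₂≡∅ to-R₁ to-R₂ (suc j) room
    with long-path X (≤-trans (ℕ.m≤n*m t 2) (≤-trans (ℕ.m≤n+m _ (suc j)) room))
  ... | [] , _ , long = contradiction (≤-trans (s≤s room) long) (ℕ.<⇒≱ (s≤s (ℕ.m≤n+m _ (suc j))))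
  ... | q ∷ Q , Q-path , long = subst (Connection R₁ X R₂) (cong suc ∣take∣≡j)
      (extend-to-connection R₁∩R₂≡∅ X∩R₁≡∅ X∩R₂≡∅ to-R₁ to-R₂ (take-path (suc j) Q-path))
    where
    j≤∣Q∣ : j ≤ length Q
    j≤∣Q∣ = ℕ.≤-pred (ℕ.+-cancelʳ-≤ (2 ℕ.* t) (suc j) (length (q ∷ Q)) (≤-trans (ℕ.m≤n⇒m≤1+n room) long))
    ∣take∣≡j : length (take j Q) ≡ j
    ∣take∣≡j = trans (length-take j Q) (ℕ.m≤n⇒m⊓n≡m j≤∣Q∣)

-- Bidirected paths in a digraph

Bidirected : Digraph n → Fin n → Fin n → Set
Bidirected D u w = Edge D u w × Edge D w u

bidirected? : (D : Digraph n) → Decidable₂ (Bidirected D)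
bidirected? D u w = (edge D u w Bool.≟ true) ×-dec (edge D w u Bool.≟ true)

BidirectedPathWithEnds : Digraph n → (U A₁ A₂ : Subset n) (k : ℕ) → Set
BidirectedPathWithEnds {n} D U A₁ A₂ k = ∃ λ (p : Fin k → Fin n) →
  IsBidirectedPath D p × Avoids U p × (∀ i → toℕ i ≡ 0 → p i ∈ A₁) × (∀ i → toℕ i ≡ k ∸ 1 → p i ∈ A₂)

module _ (D : Digraph n) {t} (bip : Bipseudorandom t D) where
  -- Bipseudorandom t D unfolds to Pseudorandom (Bidirected D) t.
  open Paths (bidirected? D) swap bip
  open ℕ-Solver using (solve; _:+_; _:*_; con; _:=_)

  connection⇒path : ∀ {U A₁ A₂ R₁ X R₂ j} → R₁ ⊆ A₁ ─ U → R₂ ⊆ A₂ ─ U → Disjoint X U →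
                    Connection R₁ X R₂ j → BidirectedPathWithEnds D U A₁ A₂ (2 ℕ.+ j)
  connection⇒path {U} {A₁} {A₂} {j = j} R₁⊆ R₂⊆ X∩U≡∅ c =
    subst (BidirectedPathWithEnds D U A₁ A₂) ∣L∣≡2+j
      (lookup L , (lookup-injective unique , lookup-linked linked) , avoids , first , last)
    where
    open Connection c
    L = start ∷ inner ++ [ end ]
    ∣inner++[end]∣ : length (inner ++ [ end ]) ≡ suc (length inner)
    ∣inner++[end]∣ = trans (length-++ inner) (+-comm (length inner) 1)
    ∣L∣≡2+j : length L ≡ 2 ℕ.+ j
    ∣L∣≡2+j = cong suc (trans ∣inner++[end]∣ (cong suc length-inner))
    L∩U≡∅ : All (_∉ U) L
    L∩U≡∅ = x∈p─q⇒x∉q (R₁⊆ start∈R₁)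
          ∷ All.++⁺ (All.map (λ {x} x∈X → X∩U≡∅ x x∈X) inner⊆X) (x∈p─q⇒x∉q (R₂⊆ end∈R₂) ∷ [])
    avoids : ∀ i → lookup L i ∉ U
    avoids i = All.lookup L∩U≡∅ (∈-lookup i)
    first : ∀ i → toℕ i ≡ 0 → lookup L i ∈ A₁
    first zero _ = p─q⊆p A₁ U (R₁⊆ start∈R₁)
    last : ∀ i → toℕ i ≡ length L ∸ 1 → lookup L i ∈ A₂
    last i i≡∣L∣∸1 = subst (_∈ A₂) (sym (lookup-∷ʳ-last (start ∷ inner) end i (trans i≡∣L∣∸1 ∣inner++[end]∣)))
                       (p─q⊆p A₂ U (R₂⊆ end∈R₂))

  path-through : ∀ {U A₁ A₂ R₁ R₂} → R₁ ⊆ A₁ ─ U → R₂ ⊆ A₂ ─ U → ∣ R₁ ∣ ≡ t → ∣ R₂ ∣ ≡ t → Disjoint R₁ R₂ →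
                 ∀ j → 2 ℕ.+ j ℕ.+ 8 ℕ.* t ℕ.+ ∣ U ∣ ≤ n → BidirectedPathWithEnds D U A₁ A₂ (2 ℕ.+ j)
  path-through {U} {A₁} {A₂} {R₁} {R₂} R₁⊆ R₂⊆ ∣R₁∣≡t ∣R₂∣≡t R₁∩R₂≡∅ j fits =
    connection⇒path R₁⊆ R₂⊆ X∩U≡∅ (connection ∣R₁∣≡t ∣R₂∣≡t R₁∩R₂≡∅ X∩R₁≡∅ X∩R₂≡∅ to-R₁ to-R₂ j room)
    where
    I₁ = isolatedFrom R₁
    I₂ = isolatedFrom R₂
    Y = blocked U R₁ R₂
    X = ∁ Y
    avoidsY : ∀ {x} → x ∈ X → x ∉ U × x ∉ R₁ × x ∉ R₂ × x ∉ I₁ × x ∉ I₂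
    avoidsY x∈X with x∉p∪q⇒x∉p×x∉q (x∈∁p⇒x∉p x∈X)
    ... | x∉U , x∉Y₁ with x∉p∪q⇒x∉p×x∉q x∉Y₁
    ... | x∉R₁ , x∉Y₂ with x∉p∪q⇒x∉p×x∉q x∉Y₂
    ... | x∉R₂ , x∉Y₃ with x∉p∪q⇒x∉p×x∉q x∉Y₃
    ... | x∉I₁ , x∉I₂ = x∉U , x∉R₁ , x∉R₂ , x∉I₁ , x∉I₂
    X∩U≡∅ : Disjoint X U
    X∩U≡∅ _ = proj₁ ∘ avoidsY
    X∩R₁≡∅ : Disjoint X R₁
    X∩R₁≡∅ _ = proj₁ ∘ proj₂ ∘ avoidsY
    X∩R₂≡∅ : Disjoint X R₂
    X∩R₂≡∅ _ = proj₁ ∘ proj₂ ∘ proj₂ ∘ avoidsY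
    to-R₁ : ∀ {x} → x ∈ X → HasNeighbourIn R₁ x
    to-R₁ x∈X = neighbourIn (X∩R₁≡∅ _ x∈X) (proj₁ (proj₂ (proj₂ (proj₂ (avoidsY x∈X)))))
    to-R₂ : ∀ {x} → x ∈ X → HasNeighbourIn R₂ x
    to-R₂ x∈X = neighbourIn (X∩R₂≡∅ _ x∈X) (proj₂ (proj₂ (proj₂ (proj₂ (avoidsY x∈X)))))
    room : j ℕ.+ 2 ℕ.* t ≤ ∣ X ∣
    room = +-cancelʳ-≤ (∣ Y ∣ ℕ.+ 2) (j ℕ.+ 2 ℕ.* t) ∣ X ∣ (begin
      j ℕ.+ 2 ℕ.* t ℕ.+ (∣ Y ∣ ℕ.+ 2)     ≤⟨ +-monoʳ-≤ (j ℕ.+ 2 ℕ.* t) (∣blocked∣+2≤ U ∣R₁∣≡t ∣R₂∣≡t) ⟩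
      j ℕ.+ 2 ℕ.* t ℕ.+ (∣ U ∣ ℕ.+ 4 ℕ.* t) ≤⟨ ℕ.m≤m+n _ (2 ℕ.+ 2 ℕ.* t) ⟩
      j ℕ.+ 2 ℕ.* t ℕ.+ (∣ U ∣ ℕ.+ 4 ℕ.* t) ℕ.+ (2 ℕ.+ 2 ℕ.* t)
        ≡⟨ solve 3 (λ j t u → j :+ con 2 :* t :+ (u :+ con 4 :* t) :+ (con 2 :+ con 2 :* t)
                               := con 2 :+ j :+ con 8 :* t :+ u) refl j t ∣ U ∣ ⟩
      2 ℕ.+ j ℕ.+ 8 ℕ.* t ℕ.+ ∣ U ∣         ≤⟨ fits ⟩
      n                                    ≡⟨ ∣X∣+∣Y∣≡n ⟨
      ∣ X ∣ ℕ.+ ∣ Y ∣                       ≤⟨ +-monoʳ-≤ ∣ X ∣ (ℕ.m≤m+n ∣ Y ∣ 2) ⟩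
      ∣ X ∣ ℕ.+ (∣ Y ∣ ℕ.+ 2)               ∎)
      where
      open ℕ.≤-Reasoning
      ∣X∣+∣Y∣≡n : ∣ X ∣ ℕ.+ ∣ Y ∣ ≡ n
      ∣X∣+∣Y∣≡n = trans (cong (ℕ._+ ∣ Y ∣) (∣∁p∣≡n∸∣p∣ Y)) (ℕ.m∸n+n≡m (∣p∣≤n Y))

  path-between : ∀ (U A₁ A₂ : Subset n) → ∣ U ∣ ℕ.+ 2 ℕ.* t ≤ ∣ A₁ ∣ → ∣ U ∣ ℕ.+ 2 ℕ.* t ≤ ∣ A₂ ∣ →
                 ∀ k → 2 ≤ k → k ℕ.+ 8 ℕ.* t ℕ.+ ∣ U ∣ ≤ n → BidirectedPathWithEnds D U A₁ A₂ k
  path-between U A₁ A₂ big₁ big₂ (suc (suc j)) (s≤s (s≤s z≤n)) fits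
    with ⊆-ofSize (A₁ ─ U) (∣q∣+m≤∣p∣⇒m≤∣p─q∣ A₁ U (≤-trans (+-monoʳ-≤ ∣ U ∣ (ℕ.m≤m+n t _)) big₁))
  ... | R₁ , R₁⊆ , ∣R₁∣≡t with ⊆-ofSize (A₂ ─ U ─ R₁) (∣q∣+m≤∣p∣⇒m≤∣p─q∣ (A₂ ─ U) R₁ ∣R₁∣+t≤)
    where
    ∣R₁∣+t≤ : ∣ R₁ ∣ ℕ.+ t ≤ ∣ A₂ ─ U ∣
    ∣R₁∣+t≤ = ≤-trans (≤-reflexive (cong (ℕ._+ t) ∣R₁∣≡t))
               (≤-trans (+-monoʳ-≤ t (ℕ.m≤m+n t 0)) (∣q∣+m≤∣p∣⇒m≤∣p─q∣ A₂ U big₂))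
  ... | R₂ , R₂⊆ , ∣R₂∣≡t =
    path-through R₁⊆ (p─q⊆p (A₂ ─ U) R₁ ∘ R₂⊆) ∣R₁∣≡t ∣R₂∣≡t (λ _ x∈R₁ x∈R₂ → x∈p─q⇒x∉q (R₂⊆ x∈R₂) x∈R₁) j fits

-- Degrees

∑outdeg≡∑indeg : ∀ (D : Digraph n) → sum (outdeg D) ≡ sum (indeg D)
∑outdeg≡∑indeg D = begin
  sum (outdeg D)                                         ≡⟨ sum-cong-≗ (λ v → ∣tabulate∣≡∑ (edge D v)) ⟩
  sum (λ v → sum (λ w → if edge D v w then 1 else 0))  ≡⟨ ∑-comm (λ v w → if edge D v w then 1 else 0) ⟩
  sum (λ w → sum (λ v → if edge D v w then 1 else 0))  ≡⟨ sum-cong-≗ (λ w → ∣tabulate∣≡∑ (λ v → edge D v w)) ⟨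
  sum (indeg D)                                          ∎
  where open ≡-Reasoning

opposite : Sign → Sign
opposite plus  = minus
opposite minus = plus

deg+deg-opposite : ∀ s (D : Digraph n) v → deg s D v ℕ.+ deg (opposite s) D v ≡ totdeg D v
deg+deg-opposite plus  D v = refl
deg+deg-opposite minus D v = +-comm (indeg D v) (outdeg D v)

∑deg≡∑deg-opposite : ∀ s (D : Digraph n) → sum (deg s D) ≡ sum (deg (opposite s) D)
∑deg≡∑deg-opposite plus  D = ∑outdeg≡∑indeg D
∑deg≡∑deg-opposite minus D = sym (∑outdeg≡∑indeg D)

deg≤n : ∀ s (D : Digraph n) v → deg s D v ≤ n
deg≤n plus  D v = ∣p∣≤n (tabulate (edge D v))
deg≤n minus D v = ∣p∣≤n (tabulate (λ w → edge D w v))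

degree-gap⇒b≤2∣P∣ : ∀ {ℓ} (D : Digraph n) s {P : Pred (Fin n) ℓ} (P? : Decidable P) b → b ≤ n →
  (∀ v → ¬ P v → b ℕ.+ deg s D v ≤ deg (opposite s) D v) → b ≤ 2 ℕ.* ∣ subsetOf P? ∣
degree-gap⇒b≤2∣P∣ {n = zero}  D s P? b b≤n _ = ≤-trans b≤n z≤n
degree-gap⇒b≤2∣P∣ {n = suc m} D s P? b b≤n low⇒gap = ℕ.*-cancelˡ-≤ (suc m) (begin
  suc m ℕ.* b                        ≤⟨ +-cancelʳ-≤ (sum d) _ _ counted ⟩
  ∣ subsetOf P? ∣ ℕ.* (2 ℕ.* suc m)
    ≡⟨ solve 2 (λ a n → a :* (con 2 :* n) := n :* (con 2 :* a)) refl ∣ subsetOf P? ∣ (suc m) ⟩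
  suc m ℕ.* (2 ℕ.* ∣ subsetOf P? ∣)   ∎)
  where
  open ℕ.≤-Reasoning
  open ℕ-Solver using (solve; _:+_; _:*_; con; _:=_)
  d d′ : Fin (suc m) → ℕ
  d  = deg s D
  d′ = deg (opposite s) D
  pointwise : ∀ v → b ℕ.+ d v ≤ d′ v ℕ.+ (if does (P? v) then 2 ℕ.* suc m else 0)
  pointwise v with P? v
  ... | yes _ = ≤-trans (ℕ.+-mono-≤ b≤n (deg≤n s D v))
                  (≤-trans (≤-reflexive (solve 1 (λ n → n :+ n := con 2 :* n) refl (suc m))) (ℕ.m≤n+m _ (d′ v)))
  ... | no ¬Pv = ≤-trans (low⇒gap v ¬Pv) (ℕ.m≤m+n (d′ v) 0)
  counted : suc m ℕ.* b ℕ.+ sum d ≤ ∣ subsetOf P? ∣ ℕ.* (2 ℕ.* suc m) ℕ.+ sum d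
  counted = ≤-trans (∑-weighted-count d d′ (does ∘ P?) b (2 ℕ.* suc m) pointwise)
              (≤-reflexive (trans (cong (ℕ._+ weight) (sym (∑deg≡∑deg-opposite s D))) (+-comm (sum d) weight)))
    where weight = ∣ subsetOf P? ∣ ℕ.* (2 ℕ.* suc m)

-- Rational estimates

-- ⟦ m ⟧ = + m / 1 reduces to this normal form only for a closed m.
⟦⟧≡mkℚ : ∀ m → ⟦ m ⟧ ≡ ℚ.mkℚ (+ m) 0 (Coprime.sym (1-coprimeTo m))
⟦⟧≡mkℚ m = ℚ.normalize-coprime (Coprime.sym (1-coprimeTo m))

⟦⟧-+ : ∀ a b → ⟦ a ℕ.+ b ⟧ ≡ ⟦ a ⟧ + ⟦ b ⟧
⟦⟧-+ a b rewrite ⟦⟧≡mkℚ a | ⟦⟧≡mkℚ b =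
  ℚ./-cong {p₁ = + (a ℕ.+ b)} (sym (cong₂ ℤ._+_ (ℤ.*-identityʳ (+ a)) (ℤ.*-identityʳ (+ b)))) refl

⟦⟧-* : ∀ a b → ⟦ a ℕ.* b ⟧ ≡ ⟦ a ⟧ * ⟦ b ⟧
⟦⟧-* a b rewrite ⟦⟧≡mkℚ a | ⟦⟧≡mkℚ b = ℚ./-cong {p₁ = + (a ℕ.* b)} (ℤ.pos-* a b) refl

⟦⟧-mono-≤ : ∀ {a b} → a ≤ b → ⟦ a ⟧ ≤ℚ ⟦ b ⟧
⟦⟧-mono-≤ {a} {b} a≤b rewrite ⟦⟧≡mkℚ a | ⟦⟧≡mkℚ b =
  ℚ.*≤* (subst₂ ℤ._≤_ (sym (ℤ.*-identityʳ (+ a))) (sym (ℤ.*-identityʳ (+ b))) (ℤ.+≤+ a≤b))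

⟦⟧-cancel-≤ : ∀ {a b} → ⟦ a ⟧ ≤ℚ ⟦ b ⟧ → a ≤ b
⟦⟧-cancel-≤ {a} {b} ⟦a⟧≤⟦b⟧ rewrite ⟦⟧≡mkℚ a | ⟦⟧≡mkℚ b with ⟦a⟧≤⟦b⟧
... | ℚ.*≤* a*1≤b*1 with subst₂ ℤ._≤_ (ℤ.*-identityʳ (+ a)) (ℤ.*-identityʳ (+ b)) a*1≤b*1
... | ℤ.+≤+ a≤b = a≤b

⟦⟧-nonNeg : ∀ m → ℚ.NonNegative ⟦ m ⟧
⟦⟧-nonNeg m = ℚ.nonNegative (⟦⟧-mono-≤ {0} {m} z≤n)

low-degree-gap : ∀ {x b d d′} → 0ℚ ≤ℚ x → b ≤ℚ x * (+ 5 / 8) → d ≤ℚ x * (+ 1 / 2) →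
                 (+ 2 / 1) * x ≤ℚ d + d′ → b + d ≤ℚ d′
low-degree-gap {x} {b} {d} {d′} 0≤x b≤ d≤ 2x≤ = begin
  b + d                          ≤⟨ ℚ.+-mono-≤ b≤ d≤ ⟩
  x * (+ 5 / 8) + x * (+ 1 / 2)  ≡⟨ ℚ.*-distribˡ-+ x (+ 5 / 8) (+ 1 / 2) ⟨
  x * (+ 9 / 8)                  ≤⟨ ℚ.*-monoˡ-≤-nonNeg x {{ℚ.nonNegative 0≤x}} (ℚ.≤ᵇ⇒≤ _) ⟩
  x * (+ 3 / 2)
    ≡⟨ solve 1 (λ x → x :* con (+ 3 / 2) := con (+ 2 / 1) :* x :- x :* con (+ 1 / 2)) refl x ⟩
  (+ 2 / 1) * x - x * (+ 1 / 2)  ≤⟨ ℚ.+-mono-≤ 2x≤ (ℚ.neg-antimono-≤ d≤) ⟩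
  d + d′ - d                     ≡⟨ solve 2 (λ d d′ → d :+ d′ :- d := d′) refl d d′ ⟩
  d′                             ∎
  where
  open ℚ.≤-Reasoning
  open ℚ-Solver using (solve; _:+_; _:*_; _:-_; con; _:=_)

2[u+2t]≤⅝αn : ∀ n u t ε α → ε * ⟦ n ⟧ ≡ ⟦ t ⟧ → ε ≤ℚ α * (+ 1 / 32) → ⟦ u ⟧ ≤ℚ α * ⟦ n ⟧ * (+ 1 / 4) →
               ⟦ 2 ℕ.* (u ℕ.+ 2 ℕ.* t) ⟧ ≤ℚ α * ⟦ n ⟧ * (+ 5 / 8)
2[u+2t]≤⅝αn n u t ε α εn≡t ε≤ u≤ = begin
  ⟦ 2 ℕ.* (u ℕ.+ 2 ℕ.* t) ⟧
    ≡⟨ trans (⟦⟧-* 2 (u ℕ.+ 2 ℕ.* t))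
             (cong (⟦ 2 ⟧ *_) (trans (⟦⟧-+ u (2 ℕ.* t)) (cong (λ q → ⟦ u ⟧ + q) (⟦⟧-* 2 t)))) ⟩
  ⟦ 2 ⟧ * (⟦ u ⟧ + ⟦ 2 ⟧ * ⟦ t ⟧)
    ≤⟨ ℚ.*-monoˡ-≤-nonNeg ⟦ 2 ⟧ (ℚ.+-mono-≤ u≤ (ℚ.*-monoˡ-≤-nonNeg ⟦ 2 ⟧ t≤)) ⟩
  ⟦ 2 ⟧ * (α * ⟦ n ⟧ * (+ 1 / 4) + ⟦ 2 ⟧ * (α * ⟦ n ⟧ * (+ 1 / 32)))
    ≡⟨ solve 2 (λ a m → con (+ 2 / 1) :* (a :* m :* con (+ 1 / 4) :+ con (+ 2 / 1) :* (a :* m :* con (+ 1 / 32)))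
                         := a :* m :* con (+ 5 / 8)) refl α ⟦ n ⟧ ⟩
  α * ⟦ n ⟧ * (+ 5 / 8) ∎
  where
  open ℚ.≤-Reasoning
  open ℚ-Solver using (solve; _:+_; _:*_; _:-_; con; _:=_)
  t≤ : ⟦ t ⟧ ≤ℚ α * ⟦ n ⟧ * (+ 1 / 32)
  t≤ = begin
    ⟦ t ⟧                   ≡⟨ εn≡t ⟨
    ε * ⟦ n ⟧               ≤⟨ ℚ.*-monoʳ-≤-nonNeg ⟦ n ⟧ {{⟦⟧-nonNeg n}} ε≤ ⟩
    α * (+ 1 / 32) * ⟦ n ⟧  ≡⟨ solve 2 (λ a m → a :* con (+ 1 / 32) :* m := a :* m :* con (+ 1 / 32)) refl α ⟦ n ⟧ ⟩
    α * ⟦ n ⟧ * (+ 1 / 32)  ∎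

⅝αn≤n : ∀ n α → α ≤ℚ + 1 / 3 → α * ⟦ n ⟧ * (+ 5 / 8) ≤ℚ ⟦ n ⟧
⅝αn≤n n α α≤⅓ = begin
  α * ⟦ n ⟧ * (+ 5 / 8)        ≤⟨ ℚ.*-monoʳ-≤-nonNeg (+ 5 / 8) (ℚ.*-monoʳ-≤-nonNeg ⟦ n ⟧ {{⟦⟧-nonNeg n}} α≤⅓) ⟩
  + 1 / 3 * ⟦ n ⟧ * (+ 5 / 8)
    ≡⟨ solve 1 (λ m → con (+ 1 / 3) :* m :* con (+ 5 / 8) := m :* con (+ 5 / 24)) refl ⟦ n ⟧ ⟩
  ⟦ n ⟧ * (+ 5 / 24)           ≤⟨ ℚ.*-monoˡ-≤-nonNeg ⟦ n ⟧ {{⟦⟧-nonNeg n}} (ℚ.≤ᵇ⇒≤ _) ⟩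
  ⟦ n ⟧ * 1ℚ                   ≡⟨ ℚ.*-identityʳ ⟦ n ⟧ ⟩
  ⟦ n ⟧                        ∎
  where
  open ℚ.≤-Reasoning
  open ℚ-Solver using (solve; _:+_; _:*_; _:-_; con; _:=_)

k+8t+u≤n : ∀ n k u t ε → ε * ⟦ n ⟧ ≡ ⟦ t ⟧ → ⟦ k ⟧ ≤ℚ (1ℚ - (+ 8 / 1) * ε) * ⟦ n ⟧ - ⟦ u ⟧ →
               k ℕ.+ 8 ℕ.* t ℕ.+ u ≤ n
k+8t+u≤n n k u t ε εn≡t k≤ = ⟦⟧-cancel-≤ (begin
  ⟦ k ℕ.+ 8 ℕ.* t ℕ.+ u ⟧
    ≡⟨ trans (⟦⟧-+ (k ℕ.+ 8 ℕ.* t) u)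
             (cong (_+ ⟦ u ⟧) (trans (⟦⟧-+ k (8 ℕ.* t)) (cong (λ q → ⟦ k ⟧ + q) (⟦⟧-* 8 t)))) ⟩
  ⟦ k ⟧ + ⟦ 8 ⟧ * ⟦ t ⟧ + ⟦ u ⟧
    ≤⟨ ℚ.+-monoˡ-≤ ⟦ u ⟧ (ℚ.+-monoˡ-≤ (⟦ 8 ⟧ * ⟦ t ⟧) k≤) ⟩
  (1ℚ - (+ 8 / 1) * ε) * ⟦ n ⟧ - ⟦ u ⟧ + ⟦ 8 ⟧ * ⟦ t ⟧ + ⟦ u ⟧
    ≡⟨ cong (λ εn → (1ℚ - (+ 8 / 1) * ε) * ⟦ n ⟧ - ⟦ u ⟧ + ⟦ 8 ⟧ * εn + ⟦ u ⟧) (sym εn≡t) ⟩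
  (1ℚ - (+ 8 / 1) * ε) * ⟦ n ⟧ - ⟦ u ⟧ + ⟦ 8 ⟧ * (ε * ⟦ n ⟧) + ⟦ u ⟧
    ≡⟨ solve 3 (λ e m w → (con 1ℚ :- con (+ 8 / 1) :* e) :* m :- w :+ con (+ 8 / 1) :* (e :* m) :+ w := m)
               refl ε ⟦ n ⟧ ⟦ u ⟧ ⟩
  ⟦ n ⟧ ∎)
  where
  open ℚ.≤-Reasoning
  open ℚ-Solver using (solve; _:+_; _:*_; _:-_; con; _:=_)

IsHighDegree : Digraph n → ℚ → Sign → Fin n → Set
IsHighDegree D x s v = x * (+ 1 / 2) ≤ℚ ⟦ deg s D v ⟧

isHighDegree? : ∀ (D : Digraph n) x s → Decidable (IsHighDegree D x s)
isHighDegree? D x s v = x * (+ 1 / 2) ℚ.≤? ⟦ deg s D v ⟧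

b≤2∣highDegree∣ : ∀ (D : Digraph n) {x} s b → 0ℚ ≤ℚ x → ⟦ b ⟧ ≤ℚ x * (+ 5 / 8) → x * (+ 5 / 8) ≤ℚ ⟦ n ⟧ →
                     (∀ v → (+ 2 / 1) * x ≤ℚ ⟦ totdeg D v ⟧) → b ≤ 2 ℕ.* ∣ subsetOf (isHighDegree? D x s) ∣
b≤2∣highDegree∣ {n} D {x} s b 0≤x b≤ ≤n δ =
  degree-gap⇒b≤2∣P∣ D s (isHighDegree? D x s) b (⟦⟧-cancel-≤ (ℚ.≤-trans b≤ ≤n)) gap
  where
  gap : ∀ v → ¬ (x * (+ 1 / 2) ≤ℚ ⟦ deg s D v ⟧) → b ℕ.+ deg s D v ≤ deg (opposite s) D v
  gap v low = ⟦⟧-cancel-≤ (subst (_≤ℚ ⟦ deg (opposite s) D v ⟧) (sym (⟦⟧-+ b (deg s D v)))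
                (low-degree-gap 0≤x b≤ (ℚ.<⇒≤ (ℚ.≰⇒> low)) total))
    where
    total : (+ 2 / 1) * x ≤ℚ ⟦ deg s D v ⟧ + ⟦ deg (opposite s) D v ⟧
    total = subst ((+ 2 / 1) * x ≤ℚ_)
              (trans (cong ⟦_⟧ (sym (deg+deg-opposite s D v))) (⟦⟧-+ (deg s D v) (deg (opposite s) D v))) (δ v)

lemma6p10 : (n : ℕ) (ε α : ℚ) (t : ℕ) →
  0ℚ < ε → ε < + 1 / 3 → 0ℚ < α → α < + 1 / 3 →
  1ℚ ≤ℚ ε * ⟦ n ⟧ → ε ≤ℚ α * (+ 1 / 32) →
  ε * ⟦ n ⟧ ≡ ⟦ t ⟧ →
  (D : Digraph n) → Bipseudorandom t D →
  (∀ v → (+ 2 / 1) * α * ⟦ n ⟧ ≤ℚ ⟦ totdeg D v ⟧) →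
  (U : Subset n) → ⟦ ∣ U ∣ ⟧ ≤ℚ α * ⟦ n ⟧ * (+ 1 / 4) →
  (k : ℕ) → 2 ≤ k → ⟦ k ⟧ ≤ℚ (1ℚ - (+ 8 / 1) * ε) * ⟦ n ⟧ - ⟦ ∣ U ∣ ⟧ →
  (s₁ s₂ : Sign) →
  ∃ λ (p : Fin k → Fin n) →
    IsBidirectedPath D p × Avoids U p ×
    (∀ i → toℕ i ≡ 0 → α * ⟦ n ⟧ * (+ 1 / 2) ≤ℚ ⟦ deg s₁ D (p i) ⟧) ×
    (∀ i → toℕ i ≡ k ∸ 1 → α * ⟦ n ⟧ * (+ 1 / 2) ≤ℚ ⟦ deg s₂ D (p i) ⟧)
-- The hypotheses 0 < ε < 1/3 and 1 ≤ εn go unused: the case t = 0 needs no care, as then no digraph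
-- is t-bipseudorandom.
lemma6p10 n ε α t _ _ 0<α α<⅓ _ ε≤α/32 εn≡t D bip δ U ∣U∣≤ k 2≤k k≤ s₁ s₂ =
  let p , path , avoids , starts , ends =
        path-between D bip U (high s₁) (high s₂) (enough s₁) (enough s₂) k 2≤k (k+8t+u≤n n k ∣ U ∣ t ε εn≡t k≤)
  in p , path , avoids , (λ i → ∈-subsetOf⁻ (isHighDegree? D x s₁) ∘ starts i)
                       , (λ i → ∈-subsetOf⁻ (isHighDegree? D x s₂) ∘ ends i)
  where
  x = α * ⟦ n ⟧
  high : Sign → Subset n
  high s = subsetOf (isHighDegree? D x s)
  0≤x : 0ℚ ≤ℚ x
  0≤x = ℚ.nonNegative⁻¹ x {{ℚ.nonNeg*nonNeg⇒nonNeg α {{ℚ.nonNegative (ℚ.<⇒≤ 0<α)}} ⟦ n ⟧ {{⟦⟧-nonNeg n}}}}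
  enough : ∀ s → ∣ U ∣ ℕ.+ 2 ℕ.* t ≤ ∣ high s ∣
  enough s = ℕ.*-cancelˡ-≤ 2 (b≤2∣highDegree∣ D s (2 ℕ.* (∣ U ∣ ℕ.+ 2 ℕ.* t)) 0≤x
    (2[u+2t]≤⅝αn n ∣ U ∣ t ε α εn≡t ε≤α/32 ∣U∣≤) (⅝αn≤n n α (ℚ.<⇒≤ α<⅓))
    (λ v → subst (_≤ℚ _) (ℚ.*-assoc (+ 2 / 1) α ⟦ n ⟧) (δ v)))
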